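{- Over a field $\mathbb F$, the family $(\mathrm{HC}^2)=(\mathrm{HC}_n^2)_{n\in\mathbb N}$ does not belong to $\mathrm{VNPC}(\trianglelefteq_{\mathsf p})$. That is, $(\mathrm{HC})\not\trianglelefteq_{\mathsf p}(\mathrm{HC}^2)$.
   Context: Let $\varepsilon$ be an indeterminate. Hamiltonian cycle polynomial and VNP. $\mathrm{HC}_n=\sum_{\pi}\prod_{i=1}^n x_{i,\pi(i)}$, where $\pi$ ranges over the $n$-cycles in $\mathfrak S_n$. VNP is the set of $\mathsf p$-families $(f)$ (sequences of polynomials with polynomially bounded number of variables and degree) that are $\mathsf p$-projections of $(\mathrm{HC})$. Projections. $f\le g$ means $f$ is obtained from $g$ by substituting each variable by a variable or a constant; constants may come from $\mathbb F(\varepsilon)$ when working over that field. Border projections. $f\trianglelefteq g$ means $f+\varepsilon h\le g$ for some polynomial $h$ over $\mathbb F[\varepsilon]$. $(f)\trianglelefteq_{\mathsf p}(g)$ means there is a polynomially bounded $t$ with $f_n\trianglelefteq g_{t(n)}$ for all $n$. Complete families. $\mathrm{VNPC}(\trianglelefteq_{\mathsf p})=\{(f)\in\mathrm{VNP}:(\mathrm{HC})\trianglelefteq_{\mathsf p}(f)\}$. -}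

module Defs where

open import Level using (Level; _⊔_; 0ℓ)
open import Algebra.Bundles using (CommutativeRing)
open import Data.Nat as ℕ using (ℕ; zero; suc; _≤_; _^_)
open import Data.Fin as Fin using (Fin; toℕ)
open import Data.Vec as Vec using (Vec; []; _∷_; lookup)
open import Data.List as List using (List; []; _∷_; foldr; map; concatMap; filterᵇ; allFin; upTo)
open import Data.Bool.ListAction using (and; or)
open import Data.Bool using (Bool; true; _∧_)
open import Data.Product using (Σ; _×_; _,_; ∃)
open import Data.Sum using (_⊎_; inj₁; inj₂)
open import Data.Unit using (⊤; tt)
open import Data.Empty using (⊥; ⊥-elim)
open import Relation.Nullary using (¬_)
open import Relation.Nullary.Decidable using (⌊_⌋)

record Field (c ℓ : Level) : Set (Level.suc (c ⊔ ℓ)) where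
  field
    commutativeRing : CommutativeRing c ℓ
  open CommutativeRing commutativeRing public
  field
    0≉1     : ¬ (0# ≈ 1#)
    inverse : ∀ x → ¬ (x ≈ 0#) → Σ Carrier λ y → x * y ≈ 1#

PolyBounded : (ℕ → ℕ) → Set
PolyBounded t = Σ ℕ λ k → ∀ n → t n ≤ k ℕ.+ n ^ k

module Over {c ℓ} (F : Field c ℓ) where
  open Field F using (Carrier; _≈_; _+_; _*_; -_; 0#; 1#)

  -- Terms of commutative F-algebras: variables from V, formal inverses
  -- of the elements indexed by I.
  data Tm {a} (V : Set) (I : Set a) : Set (c ⊔ a) where
    var : V → Tm V I
    con : Carrier → Tm V I
    _⊕_ : Tm V I → Tm V I → Tm V I
    _⊗_ : Tm V I → Tm V I → Tm V I
    ⊖_  : Tm V I → Tm V I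
    inv : I → Tm V I

  infixl 6 _⊕_
  infixl 7 _⊗_

  rename : ∀ {a b} {V W : Set} {I : Set a} {J : Set b} →
           (V → W) → (I → J) → Tm V I → Tm W J
  rename f g (var x) = var (f x)
  rename f g (con x) = con x
  rename f g (s ⊕ t) = rename f g s ⊕ rename f g t
  rename f g (s ⊗ t) = rename f g s ⊗ rename f g t
  rename f g (⊖ s)   = ⊖ rename f g s
  rename f g (inv i) = inv (g i)

  subst : ∀ {a} {V W : Set} {I : Set a} → (V → Tm W I) → Tm V I → Tm W I
  subst σ (var x) = σ x
  subst σ (con x) = con x
  subst σ (s ⊕ t) = subst σ s ⊕ subst σ t
  subst σ (s ⊗ t) = subst σ s ⊗ subst σ t
  subst σ (⊖ s)   = ⊖ subst σ s
  subst σ (inv i) = inv i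

  -- Equality in the commutative F-algebra generated by V and the formal
  -- inverses inv i, subject to  den i ⊗ inv i = 1.  For I = ⊥ this is
  -- exactly the polynomial ring F[V] (the free commutative F-algebra).
  module Eq {a} {V : Set} {I : Set a} (den : I → Tm V I) where
    infix 4 _≋_
    data _≋_ : Tm V I → Tm V I → Set (c ⊔ ℓ ⊔ a) where
      ≋-refl  : ∀ {s} → s ≋ s
      ≋-sym   : ∀ {s t} → s ≋ t → t ≋ s
      ≋-trans : ∀ {s t u} → s ≋ t → t ≋ u → s ≋ u
      ⊕-cong  : ∀ {s s′ t t′} → s ≋ s′ → t ≋ t′ → s ⊕ t ≋ s′ ⊕ t′
      ⊗-cong  : ∀ {s s′ t t′} → s ≋ s′ → t ≋ t′ → s ⊗ t ≋ s′ ⊗ t′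
      ⊖-cong  : ∀ {s s′} → s ≋ s′ → ⊖ s ≋ ⊖ s′
      ⊕-assoc : ∀ s t u → (s ⊕ t) ⊕ u ≋ s ⊕ (t ⊕ u)
      ⊕-comm  : ∀ s t → s ⊕ t ≋ t ⊕ s
      ⊕-idʳ   : ∀ s → s ⊕ con 0# ≋ s
      ⊖-invʳ  : ∀ s → s ⊕ (⊖ s) ≋ con 0#
      ⊗-assoc : ∀ s t u → (s ⊗ t) ⊗ u ≋ s ⊗ (t ⊗ u)
      ⊗-comm  : ∀ s t → s ⊗ t ≋ t ⊗ s
      ⊗-idʳ   : ∀ s → s ⊗ con 1# ≋ s
      distribʳ : ∀ s t u → s ⊗ (t ⊕ u) ≋ (s ⊗ t) ⊕ (s ⊗ u)
      con-cong : ∀ {x y} → x ≈ y → con x ≋ con y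
      con-+   : ∀ x y → con x ⊕ con y ≋ con (x + y)
      con-*   : ∀ x y → con x ⊗ con y ≋ con (x * y)
      con--   : ∀ x → ⊖ con x ≋ con (- x)
      inv-law : ∀ i → den i ⊗ inv i ≋ con 1#

  Poly : Set → Set c
  Poly V = Tm V ⊥

  infix 4 _≈P_
  _≈P_ : ∀ {V} → Poly V → Poly V → Set (c ⊔ ℓ)
  _≈P_ {V} = Eq._≋_ {V = V} ⊥-elim

  Fε : Set c
  Fε = Poly ⊤

  NZ : Set (c ⊔ ℓ)
  NZ = Σ Fε λ q → ¬ (q ≈P con 0#)

  -- F(ε)[V] = F[ε][V] localised at the nonzero elements of F[ε];
  -- the variable inj₂ tt is ε.
  RatPoly : Set → Set (c ⊔ ℓ)
  RatPoly V = Tm (V ⊎ ⊤) NZ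

  denom : ∀ {V} → NZ → RatPoly V
  denom (q , _) = rename (λ _ → inj₂ tt) ⊥-elim q

  infix 4 _≈R_
  _≈R_ : ∀ {V} → RatPoly V → RatPoly V → Set (c ⊔ ℓ)
  _≈R_ {V} = Eq._≋_ {V = V ⊎ ⊤} denom

  RatConst : Set (c ⊔ ℓ)
  RatConst = Tm ⊤ NZ

  ε : ∀ {V} → RatPoly V
  ε = var (inj₂ tt)

  liftP : ∀ {V} → Poly V → RatPoly V
  liftP = rename inj₁ ⊥-elim

  liftεP : ∀ {V} → Poly (V ⊎ ⊤) → RatPoly V
  liftεP = rename (λ x → x) ⊥-elim

  liftC : ∀ {V} → RatConst → RatPoly V
  liftC = rename (λ _ → inj₂ tt) (λ i → i)

  Var : Set
  Var = ℕ × ℕ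

  Proj : Set (c ⊔ ℓ)
  Proj = Var → Var ⊎ RatConst

  applyProj : Proj → Poly Var → RatPoly Var
  applyProj σ g = subst σ′ (liftP g)
    where
    σ′ : Var ⊎ ⊤ → RatPoly Var
    σ′ (inj₁ x) with σ x
    ... | inj₁ y = var (inj₁ y)
    ... | inj₂ k = liftC k
    σ′ (inj₂ tt) = ε

  infix 4 _⊴_
  _⊴_ : Poly Var → Poly Var → Set (c ⊔ ℓ)
  f ⊴ g = Σ (Poly (Var ⊎ ⊤)) λ h → Σ Proj λ σ →
            liftP f ⊕ ε ⊗ liftεP h ≈R applyProj σ g

  infix 4 _⊴ₚ_
  _⊴ₚ_ : (ℕ → Poly Var) → (ℕ → Poly Var) → Set (c ⊔ ℓ)
  f ⊴ₚ g = Σ (ℕ → ℕ) λ t → PolyBounded t × (∀ n → f n ⊴ g (t n))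

  allVecs : ∀ n k → List (Vec (Fin n) k)
  allVecs n zero    = [] ∷ []
  allVecs n (suc k) = concatMap (λ i → map (i ∷_) (allVecs n k)) (allFin n)

  iter : ∀ {n} → Vec (Fin n) n → ℕ → Fin n → Fin n
  iter π zero    i = i
  iter π (suc k) i = lookup π (iter π k i)

  -- π is an n-cycle: the orbit π⁰(0),…,πⁿ⁻¹(0) covers Fin n and πⁿ(0) = 0
  -- (for n = 0 the unique empty map counts, so HC₀ = 1)
  isNCycle : ∀ {n} → Vec (Fin n) n → Bool
  isNCycle {zero}  π = true
  isNCycle {suc m} π =
    and (map (λ j → or (map (λ k → ⌊ iter π k Fin.zero Fin.≟ j ⌋) (upTo (suc m))))
             (allFin (suc m)))
    ∧ ⌊ iter π (suc m) Fin.zero Fin.≟ Fin.zero ⌋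

  sumP : ∀ {V} → List (Poly V) → Poly V
  sumP = foldr _⊕_ (con 0#)

  prodP : ∀ {V} → List (Poly V) → Poly V
  prodP = foldr _⊗_ (con 1#)

  -- x_{i,j} = var (i , j)  (0-indexed)
  HC : ℕ → Poly Var
  HC n = sumP (map (λ π → prodP (map (λ i → var (toℕ i , toℕ (lookup π i))) (allFin n)))
                   (filterᵇ isNCycle (allVecs n n)))

  HC² : ℕ → Poly Var
  HC² n = HC n ⊗ HC n

open Over public

{-# OPTIONS --safe #-}

-- Already n = 1 fails, and HC₁ = x₀₀.  If x₀₀ ⊴ g² then x₀₀ + εh = B² in F(ε)[x], where B is a
-- projection of g.  The substitution x₀₀ ↦ aε, all other variables ↦ 0, maps F(ε)[x] to the
-- field F(ε) (formal inverses of nonzero q ∈ F[ε] go to 1/q) and sends x₀₀ + εh to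
-- ε(a + h₀ + O(ε)), h₀ being the constant term of h.  For a = 1 − h₀ this has ε-adic valuation 1,
-- but squares in F(ε) have even valuation.  Equality in F need not be decidable, so the
-- valuation argument and the construction of F(ε) are carried out under double negation.

module Submission where

open import Level using (_⊔_) renaming (suc to lsuc)
open import Algebra.Bundles using (CommutativeRing)
open import Algebra.Core using (Op₁; Op₂)
open import Algebra.Definitions using (Congruent₁; Congruent₂; Associative; Commutative; RightIdentity; RightInverse; _DistributesOverˡ_)
import Algebra.Consequences.Setoid as Consequences
open import Algebra.Morphism.Structures using (IsRingHomomorphism)
import Algebra.Morphism.Construct.Composition as Composition
import Algebra.Properties.Ring as RingProperties
import Algebra.Solver.Ring.NaturalCoefficients.Default as RingSolver
open import Data.Empty using (⊥; ⊥-elim)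
open import Data.List using (List; []; _∷_; map; drop)
open import Data.Nat using (ℕ; zero; suc)
open import Data.Product using (_,_)
open import Data.Sum as Sum using (_⊎_; inj₁; inj₂)
open import Data.Unit using (⊤; tt)
open import Effect.Monad using (RawMonad)
open import Function using (_∘_)
open import Relation.Binary.Bundles using (Setoid)
open import Relation.Binary.Core using (Rel)
import Relation.Binary.PropositionalEquality as ≡
open ≡ using (_≡_)
open import Relation.Binary.Structures using (IsEquivalence)
open import Relation.Nullary using (¬_; Dec; yes; no)
open import Relation.Nullary.Decidable using (¬¬-excluded-middle)
open import Relation.Nullary.Negation using (¬¬-Monad; contradiction)
open import Defs using (Field; module Over)

mkCommutativeRing : ∀ {a ℓ} {A : Set a} {_≈_ : Rel A ℓ} → IsEquivalence _≈_ →
  (_+_ _*_ : Op₂ A) (-_ : Op₁ A) (0# 1# : A) →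
  Congruent₂ _≈_ _+_ → Congruent₂ _≈_ _*_ → Congruent₁ _≈_ -_ →
  Associative _≈_ _+_ → Commutative _≈_ _+_ → RightIdentity _≈_ 0# _+_ → RightInverse _≈_ 0# -_ _+_ →
  Associative _≈_ _*_ → Commutative _≈_ _*_ → RightIdentity _≈_ 1# _*_ →
  _DistributesOverˡ_ _≈_ _*_ _+_ →
  CommutativeRing a ℓ
mkCommutativeRing {a} {ℓ} {A} {_≈_} isEq _+_ _*_ -_ 0# 1#
  +-cong *-cong -‿cong +-assoc +-comm +-identityʳ -‿inverseʳ
  *-assoc *-comm *-identityʳ distribˡ = record
  { _≈_ = _≈_ ; _+_ = _+_ ; _*_ = _*_ ; -_ = -_ ; 0# = 0# ; 1# = 1#
  ; isCommutativeRing = record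
    { isRing = record
      { +-isAbelianGroup = record
        { isGroup = record
          { isMonoid = record
            { isSemigroup = record
              { isMagma = record { isEquivalence = isEq ; ∙-cong = +-cong }
              ; assoc = +-assoc }
            ; identity = comm∧idʳ⇒id +-comm +-identityʳ }
          ; inverse = comm∧invʳ⇒inv +-comm -‿inverseʳ
          ; ⁻¹-cong = -‿cong }
        ; comm = +-comm }
      ; *-cong = *-cong
      ; *-assoc = *-assoc
      ; *-identity = comm∧idʳ⇒id *-comm *-identityʳ
      ; distrib = comm∧distrˡ⇒distr +-cong *-comm distribˡ }
    ; *-comm = *-comm } }
  where
  setoid : Setoid a ℓ
  setoid = record { isEquivalence = isEq }
  open Consequences setoid

module _ {a b ℓ₁ ℓ₂} (R₁ : CommutativeRing a ℓ₁) (R₂ : CommutativeRing b ℓ₂) where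
  private
    module R₁ = CommutativeRing R₁
    module R₂ = CommutativeRing R₂

  mkIsRingHomomorphism : ∀ {f : R₁.Carrier → R₂.Carrier} →
    (∀ {x y} → x R₁.≈ y → f x R₂.≈ f y) →
    (∀ x y → f (x R₁.+ y) R₂.≈ f x R₂.+ f y) →
    (∀ x y → f (x R₁.* y) R₂.≈ f x R₂.* f y) →
    (∀ x → f (R₁.- x) R₂.≈ R₂.- f x) →
    f R₁.0# R₂.≈ R₂.0# → f R₁.1# R₂.≈ R₂.1# →
    IsRingHomomorphism R₁.rawRing R₂.rawRing f
  mkIsRingHomomorphism f-cong +-homo *-homo -‿homo 0#-homo 1#-homo = record
    { isSemiringHomomorphism = record
      { isNearSemiringHomomorphism = record
        { +-isMonoidHomomorphism = record
          { isMagmaHomomorphism = record { isRelHomomorphism = record { cong = f-cong } ; homo = +-homo }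
          ; ε-homo = 0#-homo }
        ; *-homo = *-homo }
      ; 1#-homo = 1#-homo }
    ; -‿homo = -‿homo }

module Polynomial {c ℓ} (R : CommutativeRing c ℓ) where
  open CommutativeRing R
  open RingProperties ring using (-0#≈0#)
  open import Relation.Binary.Reasoning.Setoid setoid

  -- Coefficient lists, constant term first; trailing zeros are allowed.
  Pol : Set c
  Pol = List Carrier

  coeff : Pol → ℕ → Carrier
  coeff []      n       = 0#
  coeff (x ∷ p) zero    = x
  coeff (x ∷ p) (suc n) = coeff p n

  infix 4 _~_
  record _~_ (p q : Pol) : Set ℓ where
    constructor coeffwise
    field coeff-≈ : ∀ n → coeff p n ≈ coeff q n
  open _~_ public

  ~-isEquivalence : IsEquivalence _~_
  ~-isEquivalence = record
    { refl  = coeffwise λ n → refl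
    ; sym   = λ p~q → coeffwise λ n → sym (coeff-≈ p~q n)
    ; trans = λ p~q q~r → coeffwise λ n → trans (coeff-≈ p~q n) (coeff-≈ q~r n)
    }
  open IsEquivalence ~-isEquivalence public
    using () renaming (refl to ~-refl; sym to ~-sym; trans to ~-trans)

  ∷-cong : ∀ {x y p q} → x ≈ y → p ~ q → x ∷ p ~ y ∷ q
  ∷-cong x≈y p~q = coeffwise λ { zero → x≈y ; (suc n) → coeff-≈ p~q n }

  drop₁-cong : ∀ {p q} → p ~ q → drop 1 p ~ drop 1 q
  drop₁-cong {[]}    {[]}    p~q = ~-refl
  drop₁-cong {[]}    {_ ∷ _} p~q = coeffwise λ n → coeff-≈ p~q (suc n)
  drop₁-cong {_ ∷ _} {[]}    p~q = coeffwise λ n → coeff-≈ p~q (suc n)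
  drop₁-cong {_ ∷ _} {_ ∷ _} p~q = coeffwise λ n → coeff-≈ p~q (suc n)

  0∷[]~[] : 0# ∷ [] ~ []
  0∷[]~[] = coeffwise λ { zero → refl ; (suc n) → refl }

  infixl 6 _+ₚ_
  infixl 7 _*ₚ_ _·_

  _+ₚ_ : Op₂ Pol
  []      +ₚ q       = q
  (x ∷ p) +ₚ []      = x ∷ p
  (x ∷ p) +ₚ (y ∷ q) = x + y ∷ p +ₚ q

  -ₚ_ : Op₁ Pol
  -ₚ_ = map (-_)

  _·_ : Carrier → Pol → Pol
  x · p = map (x *_) p

  _*ₚ_ : Op₂ Pol
  []      *ₚ q = []
  (x ∷ p) *ₚ q = x · q +ₚ (0# ∷ p *ₚ q)

  1ₚ : Pol
  1ₚ = 1# ∷ []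

  X : Pol
  X = 0# ∷ 1# ∷ []

  const : Carrier → Pol
  const x = x ∷ []

  coeff-+ : ∀ p q n → coeff (p +ₚ q) n ≈ coeff p n + coeff q n
  coeff-+ []      q       n       = sym (+-identityˡ _)
  coeff-+ (x ∷ p) []      n       = sym (+-identityʳ _)
  coeff-+ (x ∷ p) (y ∷ q) zero    = refl
  coeff-+ (x ∷ p) (y ∷ q) (suc n) = coeff-+ p q n

  coeff-map : ∀ {f : Op₁ Carrier} → f 0# ≈ 0# → ∀ p n → coeff (map f p) n ≈ f (coeff p n)
  coeff-map f0≈0 []      n       = sym f0≈0
  coeff-map f0≈0 (x ∷ p) zero    = refl
  coeff-map f0≈0 (x ∷ p) (suc n) = coeff-map f0≈0 p n

  coeff-neg : ∀ p n → coeff (-ₚ p) n ≈ - coeff p n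
  coeff-neg = coeff-map -0#≈0#

  coeff-· : ∀ x p n → coeff (x · p) n ≈ x * coeff p n
  coeff-· x = coeff-map (zeroʳ x)

  +ₚ-cong : Congruent₂ _~_ _+ₚ_
  +ₚ-cong {p} {p′} {q} {q′} p~p′ q~q′ = coeffwise λ n → begin
    coeff (p +ₚ q) n         ≈⟨ coeff-+ p q n ⟩
    coeff p n + coeff q n    ≈⟨ +-cong (coeff-≈ p~p′ n) (coeff-≈ q~q′ n) ⟩
    coeff p′ n + coeff q′ n  ≈⟨ coeff-+ p′ q′ n ⟨
    coeff (p′ +ₚ q′) n       ∎

  -ₚ-cong : Congruent₁ _~_ -ₚ_
  -ₚ-cong {p} {q} p~q = coeffwise λ n → begin
    coeff (-ₚ p) n  ≈⟨ coeff-neg p n ⟩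
    - coeff p n     ≈⟨ -‿cong (coeff-≈ p~q n) ⟩
    - coeff q n     ≈⟨ coeff-neg q n ⟨
    coeff (-ₚ q) n  ∎

  ·-cong : ∀ {x y p q} → x ≈ y → p ~ q → x · p ~ y · q
  ·-cong {x} {y} {p} {q} x≈y p~q = coeffwise λ n → begin
    coeff (x · p) n  ≈⟨ coeff-· x p n ⟩
    x * coeff p n    ≈⟨ *-cong x≈y (coeff-≈ p~q n) ⟩
    y * coeff q n    ≈⟨ coeff-· y q n ⟨
    coeff (y · q) n  ∎

  +ₚ-assoc : Associative _~_ _+ₚ_
  +ₚ-assoc p q r = coeffwise λ n → begin
    coeff (p +ₚ q +ₚ r) n                ≈⟨ coeff-+ (p +ₚ q) r n ⟩
    coeff (p +ₚ q) n + coeff r n         ≈⟨ +-congʳ (coeff-+ p q n) ⟩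
    coeff p n + coeff q n + coeff r n    ≈⟨ +-assoc _ _ _ ⟩
    coeff p n + (coeff q n + coeff r n)  ≈⟨ +-congˡ (coeff-+ q r n) ⟨
    coeff p n + coeff (q +ₚ r) n         ≈⟨ coeff-+ p (q +ₚ r) n ⟨
    coeff (p +ₚ (q +ₚ r)) n              ∎

  +ₚ-comm : Commutative _~_ _+ₚ_
  +ₚ-comm p q = coeffwise λ n → begin
    coeff (p +ₚ q) n       ≈⟨ coeff-+ p q n ⟩
    coeff p n + coeff q n  ≈⟨ +-comm _ _ ⟩
    coeff q n + coeff p n  ≈⟨ coeff-+ q p n ⟨
    coeff (q +ₚ p) n       ∎

  +ₚ-identityʳ : RightIdentity _~_ [] _+ₚ_
  +ₚ-identityʳ p = coeffwise λ n → trans (coeff-+ p [] n) (+-identityʳ _)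

  -ₚ-inverseʳ : RightInverse _~_ [] -ₚ_ _+ₚ_
  -ₚ-inverseʳ p = coeffwise λ n → begin
    coeff (p +ₚ -ₚ p) n          ≈⟨ coeff-+ p (-ₚ p) n ⟩
    coeff p n + coeff (-ₚ p) n   ≈⟨ +-congˡ (coeff-neg p n) ⟩
    coeff p n - coeff p n        ≈⟨ -‿inverseʳ _ ⟩
    0#                           ∎

  ·-distribʳ : ∀ x y p → (x + y) · p ~ x · p +ₚ y · p
  ·-distribʳ x y p = coeffwise λ n → begin
    coeff ((x + y) · p) n                ≈⟨ coeff-· (x + y) p n ⟩
    (x + y) * coeff p n                  ≈⟨ distribʳ _ _ _ ⟩
    x * coeff p n + y * coeff p n        ≈⟨ +-cong (coeff-· x p n) (coeff-· y p n) ⟨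
    coeff (x · p) n + coeff (y · p) n    ≈⟨ coeff-+ (x · p) (y · p) n ⟨
    coeff (x · p +ₚ y · p) n             ∎

  ·-distribˡ : ∀ x p q → x · (p +ₚ q) ~ x · p +ₚ x · q
  ·-distribˡ x p q = coeffwise λ n → begin
    coeff (x · (p +ₚ q)) n               ≈⟨ coeff-· x (p +ₚ q) n ⟩
    x * coeff (p +ₚ q) n                 ≈⟨ *-congˡ (coeff-+ p q n) ⟩
    x * (coeff p n + coeff q n)          ≈⟨ distribˡ _ _ _ ⟩
    x * coeff p n + x * coeff q n        ≈⟨ +-cong (coeff-· x p n) (coeff-· x q n) ⟨
    coeff (x · p) n + coeff (x · q) n    ≈⟨ coeff-+ (x · p) (x · q) n ⟨
    coeff (x · p +ₚ x · q) n             ∎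

  ·-assoc : ∀ x y p → x · (y · p) ~ (x * y) · p
  ·-assoc x y p = coeffwise λ n → begin
    coeff (x · (y · p)) n  ≈⟨ coeff-· x (y · p) n ⟩
    x * coeff (y · p) n    ≈⟨ *-congˡ (coeff-· y p n) ⟩
    x * (y * coeff p n)    ≈⟨ *-assoc _ _ _ ⟨
    x * y * coeff p n      ≈⟨ coeff-· (x * y) p n ⟨
    coeff ((x * y) · p) n  ∎

  ·-identityˡ : ∀ p → 1# · p ~ p
  ·-identityˡ p = coeffwise λ n → trans (coeff-· 1# p n) (*-identityˡ _)

  ·-zeroˡ : ∀ {x} p → x ≈ 0# → x · p ~ []
  ·-zeroˡ {x} p x≈0 = coeffwise λ n → trans (coeff-· x p n) (trans (*-congʳ x≈0) (zeroˡ _))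

  ~-setoid : Setoid c ℓ
  ~-setoid = record { isEquivalence = ~-isEquivalence }

  +ₚ-middleFour : ∀ p q r s → (p +ₚ q) +ₚ (r +ₚ s) ~ (p +ₚ r) +ₚ (q +ₚ s)
  +ₚ-middleFour = Consequences.comm∧assoc⇒middleFour ~-setoid +ₚ-cong +ₚ-comm +ₚ-assoc

  +ₚ-leftComm : ∀ p q r → p +ₚ (q +ₚ r) ~ q +ₚ (p +ₚ r)
  +ₚ-leftComm p q r =
    ~-trans (~-sym (+ₚ-assoc p q r)) (~-trans (+ₚ-cong (+ₚ-comm p q) ~-refl) (+ₚ-assoc q p r))

  *ₚ-zeroʳ : ∀ p → p *ₚ [] ~ []
  *ₚ-zeroʳ []      = ~-refl
  *ₚ-zeroʳ (x ∷ p) = ~-trans (∷-cong refl (*ₚ-zeroʳ p)) 0∷[]~[]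

  *ₚ-zeroˡ : ∀ {p} q → p ~ [] → p *ₚ q ~ []
  *ₚ-zeroˡ {[]}    q p~0 = ~-refl
  *ₚ-zeroˡ {x ∷ p} q p~0 = ~-trans
    (+ₚ-cong (·-zeroˡ q (coeff-≈ p~0 0)) (∷-cong refl (*ₚ-zeroˡ {p} q (drop₁-cong p~0))))
    0∷[]~[]

  *ₚ-congˡ : ∀ {p p′} q → p ~ p′ → p *ₚ q ~ p′ *ₚ q
  *ₚ-congˡ {[]}    {p′}     q p~p′ = ~-sym (*ₚ-zeroˡ q (~-sym p~p′))
  *ₚ-congˡ {x ∷ p} {[]}     q p~p′ = *ₚ-zeroˡ q p~p′
  *ₚ-congˡ {x ∷ p} {y ∷ p′} q p~p′ =
    +ₚ-cong (·-cong (coeff-≈ p~p′ 0) ~-refl) (∷-cong refl (*ₚ-congˡ {p} q (drop₁-cong p~p′)))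

  *ₚ-congʳ : ∀ p {q q′} → q ~ q′ → p *ₚ q ~ p *ₚ q′
  *ₚ-congʳ []      q~q′ = ~-refl
  *ₚ-congʳ (x ∷ p) q~q′ = +ₚ-cong (·-cong refl q~q′) (∷-cong refl (*ₚ-congʳ p q~q′))

  *ₚ-cong : Congruent₂ _~_ _*ₚ_
  *ₚ-cong {p} {p′} {q} p~p′ q~q′ = ~-trans (*ₚ-congˡ q p~p′) (*ₚ-congʳ p′ q~q′)

  ∷-*ₚ : ∀ {x} p q → x ≈ 0# → (x ∷ p) *ₚ q ~ 0# ∷ p *ₚ q
  ∷-*ₚ p q x≈0 = +ₚ-cong (·-zeroˡ q x≈0) ~-refl

  *ₚ-∷ʳ : ∀ p y q → p *ₚ (y ∷ q) ~ y · p +ₚ (0# ∷ p *ₚ q)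
  *ₚ-∷ʳ []      y q = ~-sym 0∷[]~[]
  *ₚ-∷ʳ (x ∷ p) y q = ∷-cong (+-congʳ (*-comm x y))
    (~-trans (+ₚ-cong ~-refl (*ₚ-∷ʳ p y q)) (+ₚ-leftComm (x · q) (y · p) (0# ∷ p *ₚ q)))

  *ₚ-comm : Commutative _~_ _*ₚ_
  *ₚ-comm []      q = ~-sym (*ₚ-zeroʳ q)
  *ₚ-comm (x ∷ p) q = ~-trans (+ₚ-cong ~-refl (∷-cong refl (*ₚ-comm p q))) (~-sym (*ₚ-∷ʳ q x p))

  *ₚ-distribʳ : ∀ p q r → (p +ₚ q) *ₚ r ~ p *ₚ r +ₚ q *ₚ r
  *ₚ-distribʳ []      q       r = ~-refl
  *ₚ-distribʳ (x ∷ p) []      r = ~-sym (+ₚ-identityʳ _)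
  *ₚ-distribʳ (x ∷ p) (y ∷ q) r = ~-trans
    (+ₚ-cong (·-distribʳ x y r) (∷-cong (sym (+-identityʳ 0#)) (*ₚ-distribʳ p q r)))
    (+ₚ-middleFour (x · r) (y · r) (0# ∷ p *ₚ r) (0# ∷ q *ₚ r))

  *ₚ-distribˡ : ∀ p q r → p *ₚ (q +ₚ r) ~ p *ₚ q +ₚ p *ₚ r
  *ₚ-distribˡ p q r = ~-trans (*ₚ-comm p (q +ₚ r))
    (~-trans (*ₚ-distribʳ q r p) (+ₚ-cong (*ₚ-comm q p) (*ₚ-comm r p)))

  ·-*ₚ : ∀ x p q → (x · p) *ₚ q ~ x · (p *ₚ q)
  ·-*ₚ x []      q = ~-refl
  ·-*ₚ x (y ∷ p) q = ~-trans
    (+ₚ-cong (~-sym (·-assoc x y q)) (∷-cong (sym (zeroʳ x)) (·-*ₚ x p q)))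
    (~-sym (·-distribˡ x (y · q) (0# ∷ p *ₚ q)))

  *ₚ-assoc : Associative _~_ _*ₚ_
  *ₚ-assoc []      q r = ~-refl
  *ₚ-assoc (x ∷ p) q r = ~-trans (*ₚ-distribʳ (x · q) (0# ∷ p *ₚ q) r)
    (+ₚ-cong (·-*ₚ x q r) (~-trans (∷-*ₚ (p *ₚ q) r refl) (∷-cong refl (*ₚ-assoc p q r))))

  *ₚ-identityʳ : RightIdentity _~_ 1ₚ _*ₚ_
  *ₚ-identityʳ p = ~-trans (*ₚ-comm p 1ₚ)
    (~-trans (+ₚ-cong (·-identityˡ p) 0∷[]~[]) (+ₚ-identityʳ p))

  polynomialRing : CommutativeRing c ℓ
  polynomialRing = mkCommutativeRing ~-isEquivalence _+ₚ_ _*ₚ_ -ₚ_ [] 1ₚ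
    +ₚ-cong *ₚ-cong -ₚ-cong +ₚ-assoc +ₚ-comm +ₚ-identityʳ -ₚ-inverseʳ
    *ₚ-assoc *ₚ-comm *ₚ-identityʳ *ₚ-distribˡ

  const-isRingHomomorphism : IsRingHomomorphism rawRing (CommutativeRing.rawRing polynomialRing) const
  const-isRingHomomorphism = mkIsRingHomomorphism R polynomialRing
    (λ x≈y → ∷-cong x≈y ~-refl) (λ x y → ~-refl) (λ x y → ∷-cong (sym (+-identityʳ _)) ~-refl)
    (λ x → ~-refl) 0∷[]~[] ~-refl

  *ₚ-∷ : ∀ {y} p q → y ≈ 0# → p *ₚ (y ∷ q) ~ 0# ∷ p *ₚ q
  *ₚ-∷ p q y≈0 = ~-trans (*ₚ-∷ʳ p _ q) (+ₚ-cong (·-zeroˡ p y≈0) ~-refl)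

  ∷-~[] : ∀ {x p} → x ≈ 0# → p ~ [] → x ∷ p ~ []
  ∷-~[] x≈0 p~0 = ~-trans (∷-cong x≈0 p~0) 0∷[]~[]

  X*ₚ : ∀ p → X *ₚ p ~ 0# ∷ p
  X*ₚ p = ~-trans (∷-*ₚ (1ₚ) p refl) (∷-cong refl (~-trans (*ₚ-comm 1ₚ p) (*ₚ-identityʳ p)))

  coeff₀-X*ₚ : ∀ p → coeff (X *ₚ p) 0 ≈ 0#
  coeff₀-X*ₚ p = coeff-≈ (X*ₚ p) 0

  X*ₚ-cancel : ∀ {p q} → X *ₚ p ~ X *ₚ q → p ~ q
  X*ₚ-cancel {p} {q} Xp~Xq = drop₁-cong (~-trans (~-sym (X*ₚ p)) (~-trans Xp~Xq (X*ₚ q)))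

  ~X*ₚdrop₁ : ∀ p → coeff p 0 ≈ 0# → p ~ X *ₚ drop 1 p
  ~X*ₚdrop₁ []      _   = ~-sym (~-trans (X*ₚ []) 0∷[]~[])
  ~X*ₚdrop₁ (x ∷ p) x≈0 = ~-trans (∷-cong x≈0 ~-refl) (~-sym (X*ₚ p))

  coeff₀-*ₚ : ∀ p q → coeff (p *ₚ q) 0 ≈ coeff p 0 * coeff q 0
  coeff₀-*ₚ []      q = sym (zeroˡ _)
  coeff₀-*ₚ (x ∷ p) q = begin
    coeff (x · q +ₚ (0# ∷ p *ₚ q)) 0  ≈⟨ coeff-+ (x · q) (0# ∷ p *ₚ q) 0 ⟩
    coeff (x · q) 0 + 0#              ≈⟨ +-identityʳ _ ⟩
    coeff (x · q) 0                   ≈⟨ coeff-· x q 0 ⟩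
    x * coeff q 0                     ∎

  coeff₀-isRingHomomorphism : IsRingHomomorphism (CommutativeRing.rawRing polynomialRing) rawRing (λ p → coeff p 0)
  coeff₀-isRingHomomorphism = mkIsRingHomomorphism polynomialRing R
    (λ p~q → coeff-≈ p~q 0) (λ p q → coeff-+ p q 0) coeff₀-*ₚ (λ p → coeff-neg p 0) refl refl

-- Zero divisors are excluded only up to double negation, since equality need not be decidable.
record ¬¬IntegralDomain c ℓ : Set (lsuc (c ⊔ ℓ)) where
  field
    commutativeRing : CommutativeRing c ℓ
  open CommutativeRing commutativeRing public
  field
    1≉0               : ¬ 1# ≈ 0#
    ¬¬-noZeroDivisors : ∀ x y → x * y ≈ 0# → ¬ ¬ (x ≈ 0# ⊎ y ≈ 0#)

module FieldPolynomial {c ℓ} (F : Field c ℓ) where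
  open Field F
  open Polynomial commutativeRing
  open RawMonad (¬¬-Monad {ℓ})
  open RingSolver (CommutativeRing.commutativeSemiring polynomialRing) using (solve; _:*_; _:=_)

  x*y≈0⇒y≈0 : ∀ {x y} → ¬ x ≈ 0# → x * y ≈ 0# → y ≈ 0#
  x*y≈0⇒y≈0 {x} {y} x≉0 xy≈0 with inverse x x≉0
  ... | x⁻¹ , x*x⁻¹≈1 = begin
    y              ≈⟨ *-identityˡ y ⟨
    1# * y         ≈⟨ *-congʳ x*x⁻¹≈1 ⟨
    x * x⁻¹ * y    ≈⟨ *-congʳ (*-comm x x⁻¹) ⟩
    x⁻¹ * x * y    ≈⟨ *-assoc x⁻¹ x y ⟩
    x⁻¹ * (x * y)  ≈⟨ *-congˡ xy≈0 ⟩
    x⁻¹ * 0#       ≈⟨ zeroʳ x⁻¹ ⟩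
    0#             ∎
    where open import Relation.Binary.Reasoning.Setoid setoid

  coeff₀-*ₚ² : ∀ u q → coeff (u *ₚ (q *ₚ q)) 0 ≈ coeff u 0 * (coeff q 0 * coeff q 0)
  coeff₀-*ₚ² u q = trans (coeff₀-*ₚ u (q *ₚ q)) (*-congˡ (coeff₀-*ₚ q q))

  x*x≈0⇒¬¬x≈0 : ∀ {x} → x * x ≈ 0# → ¬ ¬ x ≈ 0#
  x*x≈0⇒¬¬x≈0 xx≈0 x≉0 = x≉0 (x*y≈0⇒y≈0 x≉0 xx≈0)

  ¬¬-noZeroDivisors : ∀ p q → p *ₚ q ~ [] → ¬ ¬ (p ~ [] ⊎ q ~ [])
  ¬¬-noZeroDivisors []      q       pq~0 = return (inj₁ ~-refl)
  ¬¬-noZeroDivisors (x ∷ p) []      pq~0 = return (inj₂ ~-refl)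
  ¬¬-noZeroDivisors (x ∷ p) (y ∷ q) pq~0 =
    ¬¬-excluded-middle >>= byCases (¬¬-noZeroDivisors p (y ∷ q)) (¬¬-noZeroDivisors (x ∷ p) q)
    where
    byCases : (p *ₚ (y ∷ q) ~ [] → ¬ ¬ (p ~ [] ⊎ y ∷ q ~ [])) →
              ((x ∷ p) *ₚ q ~ [] → ¬ ¬ (x ∷ p ~ [] ⊎ q ~ [])) →
              Dec (x ≈ 0#) → ¬ ¬ (x ∷ p ~ [] ⊎ y ∷ q ~ [])
    byCases ih _ (yes x≈0) = Sum.map₁ (∷-~[] x≈0) <$>
      ih (drop₁-cong (~-trans (~-sym (∷-*ₚ p (y ∷ q) x≈0)) pq~0))
    byCases _ ih (no x≉0) = Sum.map₂ (∷-~[] y≈0) <$>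
      ih (drop₁-cong (~-trans (~-sym (*ₚ-∷ (x ∷ p) q y≈0)) pq~0))
      where
      y≈0 : y ≈ 0#
      y≈0 = x*y≈0⇒y≈0 x≉0 (trans (sym (coeff₀-*ₚ (x ∷ p) (y ∷ q))) (coeff-≈ pq~0 0))

  polynomialDomain : ¬¬IntegralDomain c ℓ
  polynomialDomain = record
    { commutativeRing   = polynomialRing
    ; 1≉0               = λ 1~0 → 0≉1 (sym (coeff-≈ 1~0 0))
    ; ¬¬-noZeroDivisors = ¬¬-noZeroDivisors
    }

  -- If u(0) ≠ 0, comparing constant terms shows that X divides p and then q; cancelling X²
  -- gives the same equation for q/X and p/X.
  X*[u*q²]~p²⇒¬¬q~[] : ∀ u q p → ¬ coeff u 0 ≈ 0# → X *ₚ (u *ₚ (q *ₚ q)) ~ p *ₚ p → ¬ ¬ q ~ []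
  X*[u*q²]~p²⇒¬¬q~[] u []      p u₀≉0 _  = return ~-refl
  X*[u*q²]~p²⇒¬¬q~[] u (y ∷ q) p u₀≉0 eq = do
    p₀≈0 ← x*x≈0⇒¬¬x≈0
      (trans (sym (coeff₀-*ₚ p p)) (trans (sym (coeff-≈ eq 0)) (coeff₀-X*ₚ (u *ₚ (y∷q *ₚ y∷q)))))
    let uq²~Xp′² = u*q²~X*p′² p₀≈0
    y≈0 ← x*x≈0⇒¬¬x≈0 (x*y≈0⇒y≈0 u₀≉0
      (trans (sym (coeff₀-*ₚ² u y∷q)) (trans (coeff-≈ uq²~Xp′² 0) (coeff₀-X*ₚ (p′ *ₚ p′)))))
    let y∷q~Xq = ~X*ₚdrop₁ y∷q y≈0
    ∷-~[] y≈0 <$> X*[u*q²]~p²⇒¬¬q~[] u q p′ u₀≉0 (X*ₚ-cancel (begin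
      X *ₚ (X *ₚ (u *ₚ (q *ₚ q)))  ≈⟨ regroup X u q ⟩
      u *ₚ (X *ₚ q *ₚ (X *ₚ q))    ≈⟨ *ₚ-congʳ u (*ₚ-cong y∷q~Xq y∷q~Xq) ⟨
      u *ₚ (y∷q *ₚ y∷q)            ≈⟨ uq²~Xp′² ⟩
      X *ₚ (p′ *ₚ p′)              ∎))
    where
    open import Relation.Binary.Reasoning.Setoid ~-setoid
    y∷q = y ∷ q
    p′ = drop 1 p

    regroup : ∀ x u q → x *ₚ (x *ₚ (u *ₚ (q *ₚ q))) ~ u *ₚ (x *ₚ q *ₚ (x *ₚ q))
    regroup = solve 3 (λ x u q → x :* (x :* (u :* (q :* q))) := u :* (x :* q :* (x :* q))) ~-refl

    square-* : ∀ x p → x *ₚ p *ₚ (x *ₚ p) ~ x *ₚ (x *ₚ (p *ₚ p))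
    square-* = solve 2 (λ x p → x :* p :* (x :* p) := x :* (x :* (p :* p))) ~-refl

    u*q²~X*p′² : coeff p 0 ≈ 0# → u *ₚ (y∷q *ₚ y∷q) ~ X *ₚ (p′ *ₚ p′)
    u*q²~X*p′² p₀≈0 = X*ₚ-cancel (begin
      X *ₚ (u *ₚ (y∷q *ₚ y∷q))  ≈⟨ eq ⟩
      p *ₚ p                    ≈⟨ *ₚ-cong p~Xp′ p~Xp′ ⟩
      X *ₚ p′ *ₚ (X *ₚ p′)      ≈⟨ square-* X p′ ⟩
      X *ₚ (X *ₚ (p′ *ₚ p′))    ∎)
      where p~Xp′ = ~X*ₚdrop₁ p p₀≈0

module FractionField {c ℓ} (D : ¬¬IntegralDomain c ℓ) where
  open ¬¬IntegralDomain D

  open RingProperties ring using (x∙y⁻¹≈ε⇒x≈y; [y-z]x≈yx-zx; -‿distribˡ-*)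
  open RawMonad (¬¬-Monad {ℓ})
  open RingSolver commutativeSemiring using (solve; _:+_; _:*_; _:=_)
  open import Relation.Binary.Reasoning.Setoid setoid

  *-≉0 : ∀ {x y} → ¬ x ≈ 0# → ¬ y ≈ 0# → ¬ x * y ≈ 0#
  *-≉0 x≉0 y≉0 xy≈0 = ¬¬-noZeroDivisors _ _ xy≈0 Sum.[ x≉0 , y≉0 ]

  ¬¬-*-cancelʳ : ∀ {x y z} → ¬ z ≈ 0# → x * z ≈ y * z → ¬ ¬ x ≈ y
  ¬¬-*-cancelʳ {x} {y} {z} z≉0 xz≈yz =
    Sum.[ x∙y⁻¹≈ε⇒x≈y x y , (λ z≈0 → contradiction z≈0 z≉0) ] <$> ¬¬-noZeroDivisors (x - y) z (begin
      (x - y) * z    ≈⟨ [y-z]x≈yx-zx z x y ⟩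
      x * z - y * z  ≈⟨ +-congʳ xz≈yz ⟩
      y * z - y * z  ≈⟨ -‿inverseʳ (y * z) ⟩
      0#             ∎)

  record Fraction : Set (c ⊔ ℓ) where
    constructor fraction
    field
      num   : Carrier
      den   : Carrier
      den≉0 : ¬ den ≈ 0#
  open Fraction public

  infix 4 _≃_
  record _≃_ (x y : Fraction) : Set ℓ where
    constructor mk≃
    field cross-≈ : ¬ ¬ (num x * den y ≈ num y * den x)
  open _≃_ public

  ι : Carrier → Fraction
  ι a = fraction a 1# 1≉0

  infixl 6 _+ᶠ_
  infixl 7 _*ᶠ_

  _+ᶠ_ : Op₂ Fraction
  fraction a b b≉0 +ᶠ fraction c d d≉0 = fraction (a * d + c * b) (b * d) (*-≉0 b≉0 d≉0)

  _*ᶠ_ : Op₂ Fraction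
  fraction a b b≉0 *ᶠ fraction c d d≉0 = fraction (a * c) (b * d) (*-≉0 b≉0 d≉0)

  -ᶠ_ : Op₁ Fraction
  -ᶠ fraction a b b≉0 = fraction (- a) b b≉0

  ≃-isEquivalence : IsEquivalence _≃_
  ≃-isEquivalence = record
    { refl  = mk≃ (return refl)
    ; sym   = λ x≃y → mk≃ (sym <$> cross-≈ x≃y)
    ; trans = ≃-trans
    }
    where
    ≃-trans : ∀ {x y z} → x ≃ y → y ≃ z → x ≃ z
    ≃-trans {fraction a b _} {fraction c d d≉0} {fraction e f _} (mk≃ x≃y) (mk≃ y≃z) = mk≃ do
      ad≈cb ← x≃y
      cf≈ed ← y≃z
      ¬¬-*-cancelʳ d≉0 (begin
        a * f * d  ≈⟨ solve 3 (λ a d f → a :* f :* d := a :* d :* f) refl a d f ⟩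
        a * d * f  ≈⟨ *-congʳ ad≈cb ⟩
        c * b * f  ≈⟨ solve 3 (λ b c f → c :* b :* f := c :* f :* b) refl b c f ⟩
        c * f * b  ≈⟨ *-congʳ cf≈ed ⟩
        e * d * b  ≈⟨ solve 3 (λ b d e → e :* d :* b := e :* b :* d) refl b d e ⟩
        e * b * d  ∎)
  open IsEquivalence ≃-isEquivalence public
    using () renaming (refl to ≃-refl; sym to ≃-sym; trans to ≃-trans; reflexive to ≃-reflexive)

  +ᶠ-cong : Congruent₂ _≃_ _+ᶠ_
  +ᶠ-cong {fraction a b _} {fraction a′ b′ _} {fraction c d _} {fraction c′ d′ _} (mk≃ x≃x′) (mk≃ y≃y′) =
    mk≃ do
      ab′≈a′b ← x≃x′
      cd′≈c′d ← y≃y′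
      return (begin
        (a * d + c * b) * (b′ * d′)            ≈⟨ regroup a b c d b′ d′ ⟩
        a * b′ * (d * d′) + c * d′ * (b * b′)  ≈⟨ +-cong (*-congʳ ab′≈a′b) (*-congʳ cd′≈c′d) ⟩
        a′ * b * (d * d′) + c′ * d * (b * b′)  ≈⟨ regroup′ a′ b c′ d b′ d′ ⟩
        (a′ * d′ + c′ * b′) * (b * d)          ∎)
    where
    regroup : ∀ a b c d b′ d′ → (a * d + c * b) * (b′ * d′) ≈ a * b′ * (d * d′) + c * d′ * (b * b′)
    regroup = solve 6 (λ a b c d b′ d′ →
      (a :* d :+ c :* b) :* (b′ :* d′) := a :* b′ :* (d :* d′) :+ c :* d′ :* (b :* b′)) refl
    regroup′ : ∀ a′ b c′ d b′ d′ → a′ * b * (d * d′) + c′ * d * (b * b′) ≈ (a′ * d′ + c′ * b′) * (b * d)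
    regroup′ = solve 6 (λ a′ b c′ d b′ d′ →
      a′ :* b :* (d :* d′) :+ c′ :* d :* (b :* b′) := (a′ :* d′ :+ c′ :* b′) :* (b :* d)) refl

  *ᶠ-cong : Congruent₂ _≃_ _*ᶠ_
  *ᶠ-cong {fraction a b _} {fraction a′ b′ _} {fraction c d _} {fraction c′ d′ _} (mk≃ x≃x′) (mk≃ y≃y′) =
    mk≃ do
      ab′≈a′b ← x≃x′
      cd′≈c′d ← y≃y′
      return (begin
        a * c * (b′ * d′)  ≈⟨ middleFour a c b′ d′ ⟩
        a * b′ * (c * d′)  ≈⟨ *-cong ab′≈a′b cd′≈c′d ⟩
        a′ * b * (c′ * d)  ≈⟨ middleFour a′ b c′ d ⟩
        a′ * c′ * (b * d)  ∎)
    where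
    middleFour : ∀ w x y z → w * x * (y * z) ≈ w * y * (x * z)
    middleFour = solve 4 (λ w x y z → w :* x :* (y :* z) := w :* y :* (x :* z)) refl

  -ᶠ-cong : Congruent₁ _≃_ -ᶠ_
  -ᶠ-cong {fraction a b _} {fraction a′ b′ _} (mk≃ x≃x′) = mk≃ do
    ab′≈a′b ← x≃x′
    return (begin
      - a * b′    ≈⟨ -‿distribˡ-* a b′ ⟨
      - (a * b′)  ≈⟨ -‿cong ab′≈a′b ⟩
      - (a′ * b)  ≈⟨ -‿distribˡ-* a′ b ⟩
      - a′ * b    ∎)

  +ᶠ-assoc : Associative _≃_ _+ᶠ_
  +ᶠ-assoc (fraction a b _) (fraction c d _) (fraction e f _) = mk≃ (return
    (solve 6 (λ a b c d e f →
      ((a :* d :+ c :* b) :* f :+ e :* (b :* d)) :* (b :* (d :* f)) :=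
      (a :* (d :* f) :+ (c :* f :+ e :* d) :* b) :* (b :* d :* f)) refl a b c d e f))

  +ᶠ-comm : Commutative _≃_ _+ᶠ_
  +ᶠ-comm (fraction a b _) (fraction c d _) = mk≃ (return
    (solve 4 (λ a b c d → (a :* d :+ c :* b) :* (d :* b) := (c :* b :+ a :* d) :* (b :* d)) refl a b c d))

  +ᶠ-identityʳ : RightIdentity _≃_ (ι 0#) _+ᶠ_
  +ᶠ-identityʳ (fraction a b _) = mk≃ (return (begin
    (a * 1# + 0# * b) * b  ≈⟨ *-congʳ (+-congˡ (zeroˡ b)) ⟩
    (a * 1# + 0#) * b      ≈⟨ *-congʳ (+-identityʳ _) ⟩
    a * 1# * b             ≈⟨ solve 3 (λ a b o → a :* o :* b := a :* (b :* o)) refl a b 1# ⟩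
    a * (b * 1#)           ∎))

  -ᶠ-inverseʳ : RightInverse _≃_ (ι 0#) -ᶠ_ _+ᶠ_
  -ᶠ-inverseʳ (fraction a b _) = mk≃ (return (begin
    (a * b + - a * b) * 1#  ≈⟨ *-congʳ (distribʳ b a (- a)) ⟨
    (a - a) * b * 1#        ≈⟨ *-congʳ (*-congʳ (-‿inverseʳ a)) ⟩
    0# * b * 1#             ≈⟨ *-congʳ (zeroˡ b) ⟩
    0# * 1#                 ≈⟨ zeroˡ 1# ⟩
    0#                      ≈⟨ zeroˡ (b * b) ⟨
    0# * (b * b)            ∎))

  *ᶠ-assoc : Associative _≃_ _*ᶠ_
  *ᶠ-assoc (fraction a b _) (fraction c d _) (fraction e f _) = mk≃ (return
    (solve 6 (λ a b c d e f → a :* c :* e :* (b :* (d :* f)) := a :* (c :* e) :* (b :* d :* f))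
      refl a b c d e f))

  *ᶠ-comm : Commutative _≃_ _*ᶠ_
  *ᶠ-comm (fraction a b _) (fraction c d _) = mk≃ (return
    (solve 4 (λ a b c d → a :* c :* (d :* b) := c :* a :* (b :* d)) refl a b c d))

  *ᶠ-identityʳ : RightIdentity _≃_ (ι 1#) _*ᶠ_
  *ᶠ-identityʳ (fraction a b _) = mk≃ (return
    (solve 3 (λ a b o → a :* o :* b := a :* (b :* o)) refl a b 1#))

  *ᶠ-distribˡ : _DistributesOverˡ_ _≃_ _*ᶠ_ _+ᶠ_
  *ᶠ-distribˡ (fraction a b _) (fraction c d _) (fraction e f _) = mk≃ (return
    (solve 6 (λ a b c d e f →
      a :* (c :* f :+ e :* d) :* (b :* d :* (b :* f)) :=
      (a :* c :* (b :* f) :+ a :* e :* (b :* d)) :* (b :* (d :* f))) refl a b c d e f))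

  fractionRing : CommutativeRing (c ⊔ ℓ) ℓ
  fractionRing = mkCommutativeRing ≃-isEquivalence _+ᶠ_ _*ᶠ_ -ᶠ_ (ι 0#) (ι 1#)
    +ᶠ-cong *ᶠ-cong -ᶠ-cong +ᶠ-assoc +ᶠ-comm +ᶠ-identityʳ -ᶠ-inverseʳ
    *ᶠ-assoc *ᶠ-comm *ᶠ-identityʳ *ᶠ-distribˡ

  ι-cong : ∀ {a b} → a ≈ b → ι a ≃ ι b
  ι-cong a≈b = mk≃ (return (*-congʳ a≈b))

  ι-+ : ∀ a b → ι (a + b) ≃ ι a +ᶠ ι b
  ι-+ a b = mk≃ (return (solve 3 (λ a b o → (a :+ b) :* (o :* o) := (a :* o :+ b :* o) :* o) refl a b 1#))

  ι-* : ∀ a b → ι (a * b) ≃ ι a *ᶠ ι b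
  ι-* a b = mk≃ (return (*-congˡ (*-identityˡ 1#)))

  ι-isRingHomomorphism : IsRingHomomorphism rawRing (CommutativeRing.rawRing fractionRing) ι
  ι-isRingHomomorphism =
    mkIsRingHomomorphism commutativeRing fractionRing ι-cong ι-+ ι-* (λ _ → ≃-refl) ≃-refl ≃-refl

  ι-inverseʳ : ∀ {b} (b≉0 : ¬ b ≈ 0#) → ι b *ᶠ fraction 1# b b≉0 ≃ ι 1#
  ι-inverseʳ {b} _ = mk≃ (return (solve 2 (λ b o → b :* o :* o := o :* (o :* b)) refl b 1#))


module Interpretation {c ℓ} (F : Field c ℓ) {s ℓs} (S : CommutativeRing s ℓs)
  (φ : Field.Carrier F → CommutativeRing.Carrier S) where
  open Over F using (Tm; var; con; _⊕_; _⊗_; ⊖_; inv; rename; module Eq)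
  open CommutativeRing S

  ⟦_⟧ : ∀ {a} {V : Set} {I : Set a} → Tm V I → (V → Carrier) → (I → Carrier) → Carrier
  ⟦ var x ⟧ ρ ι = ρ x
  ⟦ con x ⟧ ρ ι = φ x
  ⟦ s ⊕ t ⟧ ρ ι = ⟦ s ⟧ ρ ι + ⟦ t ⟧ ρ ι
  ⟦ s ⊗ t ⟧ ρ ι = ⟦ s ⟧ ρ ι * ⟦ t ⟧ ρ ι
  ⟦ ⊖ s ⟧   ρ ι = - ⟦ s ⟧ ρ ι
  ⟦ inv i ⟧ ρ ι = ι i

  ⟦⟧-rename : ∀ {a b} {V W : Set} {I : Set a} {J : Set b} (f : V → W) (g : I → J) t
              (ρ : W → Carrier) (ι : J → Carrier) → ⟦ rename f g t ⟧ ρ ι ≡ ⟦ t ⟧ (ρ ∘ f) (ι ∘ g)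
  ⟦⟧-rename f g (var x) ρ ι = ≡.refl
  ⟦⟧-rename f g (con x) ρ ι = ≡.refl
  ⟦⟧-rename f g (s ⊕ t) ρ ι = ≡.cong₂ _+_ (⟦⟧-rename f g s ρ ι) (⟦⟧-rename f g t ρ ι)
  ⟦⟧-rename f g (s ⊗ t) ρ ι = ≡.cong₂ _*_ (⟦⟧-rename f g s ρ ι) (⟦⟧-rename f g t ρ ι)
  ⟦⟧-rename f g (⊖ s)   ρ ι = ≡.cong -_ (⟦⟧-rename f g s ρ ι)
  ⟦⟧-rename f g (inv i) ρ ι = ≡.refl

  module _ (φ-isRingHomomorphism : IsRingHomomorphism (Field.rawRing F) rawRing φ) where
    open IsRingHomomorphism φ-isRingHomomorphism

    ⟦⟧-sound : ∀ {a} {V : Set} {I : Set a} (den : I → Tm V I) {ρ ι} →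
               (∀ i → ⟦ den i ⟧ ρ ι * ι i ≈ 1#) →
               ∀ {s t} → Eq._≋_ den s t → ⟦ s ⟧ ρ ι ≈ ⟦ t ⟧ ρ ι
    ⟦⟧-sound den {ρ} {ι} den*ι≈1 = sound
      where
      open Eq den
      sound : ∀ {s t} → s ≋ t → ⟦ s ⟧ ρ ι ≈ ⟦ t ⟧ ρ ι
      sound ≋-refl              = refl
      sound (≋-sym e)           = sym (sound e)
      sound (≋-trans e f)       = trans (sound e) (sound f)
      sound (⊕-cong e f)        = +-cong (sound e) (sound f)
      sound (⊗-cong e f)        = *-cong (sound e) (sound f)
      sound (⊖-cong e)          = -‿cong (sound e)
      sound (⊕-assoc s t u)     = +-assoc _ _ _
      sound (⊕-comm s t)        = +-comm _ _
      sound (⊕-idʳ s)           = trans (+-congˡ 0#-homo) (+-identityʳ _)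
      sound (⊖-invʳ s)          = trans (-‿inverseʳ _) (sym 0#-homo)
      sound (⊗-assoc s t u)     = *-assoc _ _ _
      sound (⊗-comm s t)        = *-comm _ _
      sound (⊗-idʳ s)           = trans (*-congˡ 1#-homo) (*-identityʳ _)
      sound (Eq.distribʳ s t u) = distribˡ _ _ _    -- Eq.distribʳ is left distributivity
      sound (con-cong x≈y)      = ⟦⟧-cong x≈y
      sound (con-+ x y)         = sym (+-homo x y)
      sound (con-* x y)         = sym (*-homo x y)
      sound (con-- x)           = sym (-‿homo x)
      sound (inv-law i)         = trans (den*ι≈1 i) (sym 1#-homo)

module InterpretationHomomorphism {c ℓ} (F : Field c ℓ)
  {s₁ ℓ₁} (S₁ : CommutativeRing s₁ ℓ₁) (φ₁ : Field.Carrier F → CommutativeRing.Carrier S₁)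
  {s₂ ℓ₂} (S₂ : CommutativeRing s₂ ℓ₂) (φ₂ : Field.Carrier F → CommutativeRing.Carrier S₂) where
  open Over F using (Tm; var; con; _⊕_; _⊗_; ⊖_; inv)
  open CommutativeRing S₂
  open Interpretation F S₁ φ₁ using () renaming (⟦_⟧ to ⟦_⟧₁)
  open Interpretation F S₂ φ₂ using () renaming (⟦_⟧ to ⟦_⟧₂)

  ⟦⟧-homo : ∀ {ψ} → IsRingHomomorphism (CommutativeRing.rawRing S₁) rawRing ψ →
            (∀ x → ψ (φ₁ x) ≈ φ₂ x) →
            ∀ {a} {V : Set} {I : Set a} (t : Tm V I) {ρ₁ ι₁ ρ₂ ι₂} →
            (∀ v → ψ (ρ₁ v) ≈ ρ₂ v) → (∀ i → ψ (ι₁ i) ≈ ι₂ i) →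
            ψ (⟦ t ⟧₁ ρ₁ ι₁) ≈ ⟦ t ⟧₂ ρ₂ ι₂
  ⟦⟧-homo {ψ} ψ-isRingHomomorphism ψφ₁≈φ₂ t {ρ₁} {ι₁} {ρ₂} {ι₂} ψρ₁≈ρ₂ ψι₁≈ι₂ = homo t
    where
    open IsRingHomomorphism ψ-isRingHomomorphism
    homo : ∀ t → ψ (⟦ t ⟧₁ ρ₁ ι₁) ≈ ⟦ t ⟧₂ ρ₂ ι₂
    homo (var x) = ψρ₁≈ρ₂ x
    homo (con x) = ψφ₁≈φ₂ x
    homo (s ⊕ t) = trans (+-homo _ _) (+-cong (homo s) (homo t))
    homo (s ⊗ t) = trans (*-homo _ _) (*-cong (homo s) (homo t))
    homo (⊖ s)   = trans (-‿homo _) (-‿cong (homo s))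
    homo (inv i) = ψι₁≈ι₂ i

module UnivariateNormalForm {c ℓ} (F : Field c ℓ) where
  open Field F using (0#; 1#; commutativeRing)
  open Over F using (Fε; _≈P_; var; con; _⊕_; _⊗_; ⊖_; module Eq)
  open Eq {V = ⊤} {I = ⊥} ⊥-elim
  open Polynomial commutativeRing
  open Interpretation F polynomialRing const using (⟦_⟧)

  termRing : CommutativeRing c (c ⊔ ℓ)
  termRing = mkCommutativeRing
    (record { refl = ≋-refl ; sym = ≋-sym ; trans = ≋-trans }) _⊕_ _⊗_ ⊖_ (con 0#) (con 1#)
    ⊕-cong ⊗-cong ⊖-cong ⊕-assoc ⊕-comm ⊕-idʳ ⊖-invʳ ⊗-assoc ⊗-comm ⊗-idʳ distribʳ

  private
    module T = CommutativeRing termRing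
  open RingProperties T.ring using (-0#≈0#; -‿distribʳ-*; -‿+-comm)
  open RingSolver T.commutativeSemiring using (solve; _:+_; _:*_; _:=_)

  ε : Fε
  ε = var tt

  evalε : Fε → Pol
  evalε q = ⟦ q ⟧ (λ _ → X) ⊥-elim

  reify : Pol → Fε
  reify []      = con 0#
  reify (x ∷ p) = con x ⊕ ε ⊗ reify p

  reify-const : ∀ x → reify (const x) ≈P con x
  reify-const x = ≋-trans (⊕-cong ≋-refl (T.zeroʳ ε)) (⊕-idʳ _)

  reify-X : reify X ≈P ε
  reify-X = ≋-trans (T.+-identityˡ _) (≋-trans (⊗-cong ≋-refl (reify-const 1#)) (⊗-idʳ ε))

  reify-+ : ∀ p q → reify (p +ₚ q) ≈P reify p ⊕ reify q
  reify-+ []      q       = ≋-sym (T.+-identityˡ _)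
  reify-+ (x ∷ p) []      = ≋-sym (⊕-idʳ _)
  reify-+ (x ∷ p) (y ∷ q) = ≋-trans (⊕-cong (≋-sym (con-+ x y)) (⊗-cong ≋-refl (reify-+ p q)))
    (solve 5 (λ x y e p q → x :+ y :+ e :* (p :+ q) := x :+ e :* p :+ (y :+ e :* q)) ≋-refl
      (con x) (con y) ε (reify p) (reify q))

  reify-· : ∀ x p → reify (x · p) ≈P con x ⊗ reify p
  reify-· x []      = ≋-sym (≋-trans (con-* x 0#) (con-cong (Field.zeroʳ F x)))
  reify-· x (y ∷ p) = ≋-trans (⊕-cong (≋-sym (con-* x y)) (⊗-cong ≋-refl (reify-· x p)))
    (solve 4 (λ x y e p → x :* y :+ e :* (x :* p) := x :* (y :+ e :* p)) ≋-refl
      (con x) (con y) ε (reify p))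

  reify-* : ∀ p q → reify (p *ₚ q) ≈P reify p ⊗ reify q
  reify-* []      q = ≋-sym (T.zeroˡ _)
  reify-* (x ∷ p) q = ≋-trans (reify-+ (x · q) (0# ∷ p *ₚ q))
    (≋-trans (⊕-cong (reify-· x q) (≋-trans (T.+-identityˡ _) (⊗-cong ≋-refl (reify-* p q))))
      (solve 4 (λ x q e p → x :* q :+ e :* (p :* q) := (x :+ e :* p) :* q) ≋-refl
        (con x) (reify q) ε (reify p)))

  reify-neg : ∀ p → reify (-ₚ p) ≈P ⊖ reify p
  reify-neg []      = ≋-sym -0#≈0#
  reify-neg (x ∷ p) = ≋-trans
    (⊕-cong (≋-sym (con-- x)) (≋-trans (⊗-cong ≋-refl (reify-neg p)) (≋-sym (-‿distribʳ-* ε (reify p)))))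
    (-‿+-comm (con x) (ε ⊗ reify p))

  reify-~[] : ∀ {p} → p ~ [] → reify p ≈P con 0#
  reify-~[] {[]}    p~0 = ≋-refl
  reify-~[] {x ∷ p} p~0 = ≋-trans
    (⊕-cong (con-cong (coeff-≈ p~0 0)) (≋-trans (⊗-cong ≋-refl (reify-~[] {p} (drop₁-cong p~0))) (T.zeroʳ ε)))
    (⊕-idʳ _)

  reify-evalε : ∀ q → q ≈P reify (evalε q)
  reify-evalε (var tt) = ≋-sym reify-X
  reify-evalε (con x)  = ≋-sym (reify-const x)
  reify-evalε (s ⊕ t) = ≋-trans (⊕-cong (reify-evalε s) (reify-evalε t)) (≋-sym (reify-+ (evalε s) (evalε t)))
  reify-evalε (s ⊗ t) = ≋-trans (⊗-cong (reify-evalε s) (reify-evalε t)) (≋-sym (reify-* (evalε s) (evalε t)))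
  reify-evalε (⊖ s)   = ≋-trans (⊖-cong (reify-evalε s)) (≋-sym (reify-neg (evalε s)))

  evalε-≁[] : ∀ {q} → ¬ q ≈P con 0# → ¬ evalε q ~ []
  evalε-≁[] {q} q≉0 evalεq~0 = q≉0 (≋-trans (reify-evalε q) (reify-~[] evalεq~0))


module BorderSquare {c ℓ} (F : Field c ℓ) where
  open Field F using (Carrier; _≈_; _-_; 0#; 1#; 0≉1; refl; sym; trans; +-congˡ; ring; commutativeRing)
  open Over F
  open Polynomial commutativeRing
  open FieldPolynomial F using (polynomialDomain; X*[u*q²]~p²⇒¬¬q~[])
  open UnivariateNormalForm F using (evalε; evalε-≁[])
  open RingProperties ring using (//-rightDividesˡ)

  open FractionField polynomialDomain

  φ : Carrier → Fraction
  φ = ι ∘ const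

  φ-isRingHomomorphism : IsRingHomomorphism (Field.rawRing F) (CommutativeRing.rawRing fractionRing) φ
  φ-isRingHomomorphism = Composition.isRingHomomorphism ≃-trans
    const-isRingHomomorphism ι-isRingHomomorphism

  open Interpretation F polynomialRing const using () renaming (⟦_⟧ to ⟦_⟧ₚ)
  open Interpretation F commutativeRing (λ x → x) using () renaming (⟦_⟧ to ⟦_⟧₀)
  open Interpretation F fractionRing φ using (⟦⟧-rename; ⟦⟧-sound) renaming (⟦_⟧ to ⟦_⟧ᶠ)
  open InterpretationHomomorphism F polynomialRing const fractionRing φ
    using () renaming (⟦⟧-homo to ι-⟦⟧)
  open InterpretationHomomorphism F polynomialRing const commutativeRing (λ x → x)
    using () renaming (⟦⟧-homo to coeff₀-⟦⟧)

  ρ : Carrier → Var ⊎ ⊤ → Pol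
  ρ a (inj₁ (zero , zero))  = X *ₚ const a
  ρ a (inj₁ (zero , suc _)) = []
  ρ a (inj₁ (suc _ , _))    = []
  ρ a (inj₂ tt)             = X

  coeff₀-ρ : ∀ a v → coeff (ρ a v) 0 ≈ 0#
  coeff₀-ρ a (inj₁ (zero , zero))  = coeff₀-X*ₚ (const a)
  coeff₀-ρ a (inj₁ (zero , suc _)) = refl
  coeff₀-ρ a (inj₁ (suc _ , _))    = refl
  coeff₀-ρ a (inj₂ tt)             = refl

  X*u≄square : ∀ {u} → ¬ coeff u 0 ≈ 0# → ∀ f → ¬ ι (X *ₚ u) ≃ f *ᶠ f
  X*u≄square {u} u₀≉0 (fraction p q q≉0) Xu≃f² = cross-≈ Xu≃f² λ Xu*q²~p²*1 →
    X*[u*q²]~p²⇒¬¬q~[] u q p u₀≉0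
      (~-trans (~-sym (*ₚ-assoc X u (q *ₚ q))) (~-trans Xu*q²~p²*1 (*ₚ-identityʳ (p *ₚ p))))
      q≉0

  invᶠ : NZ → Fraction
  invᶠ (q , q≉0) = fraction 1ₚ (evalε q) (evalε-≁[] q≉0)

  ⟦rename⟧ᶠ : ∀ a {W : Set} (f : W → Var ⊎ ⊤) (t : Poly W) →
              ⟦ rename f ⊥-elim t ⟧ᶠ (ι ∘ ρ a) invᶠ ≃ ι (⟦ t ⟧ₚ (ρ a ∘ f) ⊥-elim)
  ⟦rename⟧ᶠ a f t = ≃-trans (≃-reflexive (⟦⟧-rename f ⊥-elim t (ι ∘ ρ a) invᶠ))
    (≃-sym (ι-⟦⟧ ι-isRingHomomorphism (λ _ → ≃-refl) t (λ _ → ≃-refl) λ ()))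

  denom*invᶠ≃1 : ∀ a i → ⟦ denom i ⟧ᶠ (ι ∘ ρ a) invᶠ *ᶠ invᶠ i ≃ ι 1ₚ
  denom*invᶠ≃1 a (q , q≉0) = ≃-trans
    (*ᶠ-cong (⟦rename⟧ᶠ a (λ _ → inj₂ tt) q) (≃-refl {invᶠ (q , q≉0)}))
    (ι-inverseʳ (evalε-≁[] q≉0))

  coeff₀-⟦⟧ₚ : ∀ a t → coeff (⟦ t ⟧ₚ (ρ a) ⊥-elim) 0 ≈ ⟦ t ⟧₀ (λ _ → 0#) ⊥-elim
  coeff₀-⟦⟧ₚ a t = coeff₀-⟦⟧ coeff₀-isRingHomomorphism (λ _ → refl) t (coeff₀-ρ a) λ ()

  -- liftεP (HC₁+εh h) computes to the left-hand side  liftP (HC 1) ⊕ ε ⊗ liftεP h  of  _⊴_.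
  HC₁+εh : Poly (Var ⊎ ⊤) → Poly (Var ⊎ ⊤)
  HC₁+εh h = rename inj₁ ⊥-elim (HC 1) ⊕ var (inj₂ tt) ⊗ h

  ⟦HC₁+εh⟧ₚ : ∀ a h → ⟦ HC₁+εh h ⟧ₚ (ρ a) ⊥-elim ~ X *ₚ (const a +ₚ ⟦ h ⟧ₚ (ρ a) ⊥-elim)
  ⟦HC₁+εh⟧ₚ a h = begin
    Xa *ₚ 1ₚ +ₚ const 0# +ₚ XH  ≈⟨ +ₚ-cong (+ₚ-cong (*ₚ-identityʳ Xa) 0∷[]~[]) (~-refl {XH}) ⟩
    Xa +ₚ [] +ₚ XH              ≈⟨ +ₚ-cong (+ₚ-identityʳ Xa) (~-refl {XH}) ⟩
    Xa +ₚ XH                    ≈⟨ *ₚ-distribˡ X (const a) H ⟨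
    X *ₚ (const a +ₚ H)         ∎
    where
    open import Relation.Binary.Reasoning.Setoid ~-setoid
    H = ⟦ h ⟧ₚ (ρ a) ⊥-elim
    Xa = X *ₚ const a
    XH = X *ₚ H

  HC₁⋬square : ∀ g → ¬ HC 1 ⊴ g ⊗ g
  HC₁⋬square g (h , σ , HC₁+εh≈g²) = X*u≄square u₀≉0 B (begin
    ι (X *ₚ u)                              ≈⟨ ι-cong (⟦HC₁+εh⟧ₚ a h) ⟨
    ι (⟦ HC₁+εh h ⟧ₚ (ρ a) ⊥-elim)          ≈⟨ ⟦rename⟧ᶠ a (λ x → x) (HC₁+εh h) ⟨
    ⟦ liftεP (HC₁+εh h) ⟧ᶠ (ι ∘ ρ a) invᶠ   ≈⟨ ⟦⟧-sound φ-isRingHomomorphism denom (denom*invᶠ≃1 a) HC₁+εh≈g² ⟩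
    B *ᶠ B                                  ∎)
    where
    open import Relation.Binary.Reasoning.Setoid (CommutativeRing.setoid fractionRing)
    h₀ = ⟦ h ⟧₀ (λ _ → 0#) ⊥-elim
    -- chosen so that u has constant term 1, whatever h₀ is
    a = 1# - h₀
    H = ⟦ h ⟧ₚ (ρ a) ⊥-elim
    u = const a +ₚ H
    B = ⟦ applyProj σ g ⟧ᶠ (ι ∘ ρ a) invᶠ

    u₀≉0 : ¬ coeff u 0 ≈ 0#
    u₀≉0 u₀≈0 = 0≉1 (trans (sym u₀≈0)
      (trans (coeff-+ (const a) H 0) (trans (+-congˡ (coeff₀-⟦⟧ₚ a h)) (//-rightDividesˡ h₀ 1#))))

open Defs using (HC; HC²; _⊴ₚ_)

lemma2 : ∀ {c ℓ} (F : Field c ℓ) → ¬ (_⊴ₚ_ F (HC F) (HC² F))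
lemma2 F (t , _ , HC⊴ₚHC²) = BorderSquare.HC₁⋬square F (HC F (t 1)) (HC⊴ₚHC² 1)
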